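{- For every integer $k\geq1$, the maximum star-arboricity of a graph of treewidth at most $k$ is $k+1$.
   Context: Graphs are finite and simple. A $k$-tree is defined recursively: $K_{k+1}$ is a $k$-tree, and if $G$ has a vertex $v$ whose neighbourhood is a $k$-clique and $G-v$ is a $k$-tree then $G$ is a $k$-tree. The treewidth of $G$ is the minimum $k$ such that $G$ is a spanning subgraph of a $k$-tree. A star is a tree of diameter at most 2; a star-forest is a graph each of whose components is a star. The star-arboricity of $G$ is the minimum number of star-forests whose edge sets partition $E(G)$. -}

module Defs where

open import Data.Nat using (ℕ; zero; suc; _≤_)
open import Data.Bool using (Bool; true; false; _∧_)
open import Data.Fin using (Fin; punchIn; _≟_)
open import Data.Product using (Σ; ∃; _×_; _,_)
open import Data.Sum using (_⊎_)
open import Function.Definitions using (Injective)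
open import Relation.Binary.PropositionalEquality using (_≡_; _≢_)
open import Relation.Binary.Construct.Closure.ReflexiveTransitive using (Star)
open import Relation.Nullary.Decidable using (⌊_⌋)

record Graph (n : ℕ) : Set where
  field
    adj   : Fin n → Fin n → Bool
    adj-sym : ∀ u v → adj u v ≡ adj v u
    irrefl : ∀ u → adj u u ≡ false
open Graph public

delete : ∀ {n} → Graph (suc n) → Fin (suc n) → Graph n
delete G v = record
  { adj = λ a b → adj G (punchIn v a) (punchIn v b)
  ; adj-sym = λ a b → adj-sym G (punchIn v a) (punchIn v b)
  ; irrefl = λ a → irrefl G (punchIn v a) }

-- k-trees, by the recursive definition.
-- base: the complete graph K_{k+1};
-- step: G has a vertex v whose neighbourhood is a k-clique (given by an injective
--   enumeration f of the neighbours of v in G - v), and G - v is a k-tree.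
data KTree (k : ℕ) : {n : ℕ} → Graph n → Set where
  base : (G : Graph (suc k)) →
         (∀ u v → u ≢ v → adj G u v ≡ true) →
         KTree k G
  step : ∀ {n} (G : Graph (suc n)) (v : Fin (suc n)) (f : Fin k → Fin n) →
         Injective _≡_ _≡_ f →
         (∀ a → adj G v (punchIn v a) ≡ true → ∃ λ i → f i ≡ a) →
         (∀ i → adj G v (punchIn v (f i)) ≡ true) →
         (∀ i j → i ≢ j → adj G (punchIn v (f i)) (punchIn v (f j)) ≡ true) →
         KTree k (delete G v) →
         KTree k G

SpanningSubgraph : ∀ {n} → Graph n → Graph n → Set
SpanningSubgraph G H = ∀ u v → adj G u v ≡ true → adj H u v ≡ true

TreewidthAtMost : ∀ {n} → ℕ → Graph n → Set
TreewidthAtMost {n} k G =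
  ∃ λ j → j ≤ k × Σ (Graph n) λ H → KTree j H × SpanningSubgraph G H

Reach : ∀ {n} → (Fin n → Fin n → Bool) → Fin n → Fin n → Set
Reach A = Star (λ x y → A x y ≡ true)

-- Star-forest: every component (the vertices reachable from u) is a star, i.e.
-- it contains a centre c incident with every edge of the component.
IsStarForest : ∀ {n} → (Fin n → Fin n → Bool) → Set
IsStarForest {n} A =
  ∀ (u : Fin n) → ∃ λ c → Reach A u c ×
    (∀ x y → Reach A u x → A x y ≡ true → (x ≡ c) ⊎ (y ≡ c))

colourClass : ∀ {n m} → Graph n → (Fin n → Fin n → Fin m) → Fin m →
              Fin n → Fin n → Bool
colourClass G c i u v = adj G u v ∧ ⌊ c u v ≟ i ⌋

-- E(G) can be partitioned into m star-forests (star-arboricity ≤ m):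
-- a (symmetric) assignment of one of m colours to each edge such that
-- every colour class is a star-forest.
StarArboricityAtMost : ∀ {n} → ℕ → Graph n → Set
StarArboricityAtMost {n} m G =
  Σ (Fin n → Fin n → Fin m) λ c →
    (∀ u v → c u v ≡ c v u) × (∀ i → IsStarForest (colourClass G c i))

{-# OPTIONS --safe #-}
-- Upper bound: building a j-tree vertex by vertex gives an ordering and a proper
-- (j+1)-colouring in which the earlier neighbours of each vertex (a clique) get distinct
-- colours.  Colour every edge by the colour of its earlier endpoint.  In class i, a vertex
-- of colour i only meets later vertices, and any other vertex has at most one edge (to its
-- unique earlier neighbour of colour i), so every class is a star forest.
--
-- Lower bound: let k vertices K have k²+1 common neighbours x, each with one more neighbour
-- y outside K.  In a partition into k star forests two of the k+1 edges at x get the same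
-- colour, which forces x to be the centre of the star through some vertex of K in that
-- colour; but there are only k² such pairs (vertex, colour).  The whole graph sits inside a
-- k-tree.
module Submission where

open import Defs
open import Data.Nat using (ℕ; suc; _≥_)
open import Data.Product using (Σ; _×_)
open import Relation.Nullary using (¬_)

open import Data.Bool using (Bool; true; false)
open import Data.Bool.Properties using () renaming (_≟_ to _≟ᵇ_)
open import Data.Empty using (⊥-elim)
open import Data.Fin using (Fin; zero; suc; punchIn; punchOut; inject≤; toℕ; combine; _≟_)
open import Data.Fin.Properties
  using (any?; ¬∀⟶∃¬; pigeonhole; <⇒notInjective; combine-injective; punchIn-punchOut;
         inject≤-injective; toℕ<n; toℕ-injective; suc-injective)
  renaming (<⇒≢ to <⇒≢ᶠ)
open import Data.Nat using (zero; _<_; _≤_; _*_; s≤s)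
open import Data.Nat.Properties
  using (n<1+n; m<n⇒m<1+n; <-asym; <-irrefl; ≮⇒≥; ≤∧≢⇒<; ≤-antisym; _<?_;
         ≤-refl)
open import Data.Product using (∃; ∃₂; _,_; proj₁; proj₂)
import Data.Product as Product
open import Data.Product.Properties using (×-≡,≡→≡)
open import Data.Sum using (_⊎_; inj₁; inj₂)
open import Data.Vec.Functional using (insertAt; _∷_)
open import Data.Vec.Functional.Properties using (insertAt-lookup; insertAt-punchIn)
open import Function using (_∘_)
open import Function.Definitions using (Injective)
open import Relation.Binary.Construct.Closure.ReflexiveTransitive using (ε; _◅_)
open import Relation.Binary.PropositionalEquality
  using (_≡_; _≢_; refl; sym; trans; cong; subst; module ≡-Reasoning)
open import Relation.Nullary using (Dec; yes; no)
open import Relation.Nullary.Decidable using (⌊_⌋; dec-true; isYes≗does)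

<⇒∃-∉-image : ∀ {k m} → k < m → (f : Fin k → Fin m) →
              ∃ λ c → ∀ i → f i ≢ c
<⇒∃-∉-image {k} {m} k<m f =
  Product.map₂ (λ c∉ i fi≡c → c∉ (i , fi≡c))
    (¬∀⟶∃¬ m _ (λ c → any? (λ i → f i ≟ c))
      (λ onto → <⇒notInjective k<m (section-injective onto)))
  where
  section-injective : (onto : ∀ c → ∃ λ i → f i ≡ c) →
                      Injective _≡_ _≡_ (proj₁ ∘ onto)
  section-injective onto {c} {c′} eq =
    trans (sym (proj₂ (onto c))) (trans (cong f eq) (proj₂ (onto c′)))

injective-∷ : ∀ {k n} {y : Fin n} {K : Fin k → Fin n} →
              Injective _≡_ _≡_ K → (∀ a → K a ≢ y) → Injective _≡_ _≡_ (y ∷ K)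
injective-∷ K-inj y∉K {zero}  {zero}  _  = refl
injective-∷ K-inj y∉K {zero}  {suc b} eq = ⊥-elim (y∉K b (sym eq))
injective-∷ K-inj y∉K {suc a} {zero}  eq = ⊥-elim (y∉K a eq)
injective-∷ K-inj y∉K {suc a} {suc b} eq = cong suc (K-inj eq)

isYes-true : ∀ {P : Set} (P? : Dec P) → P → ⌊ P? ⌋ ≡ true
isYes-true P? p = trans (isYes≗does P?) (dec-true P? p)

data PunchInView {n} (v : Fin (suc n)) : Fin (suc n) → Set where
  pivot : PunchInView v v
  old   : (a : Fin n) → PunchInView v (punchIn v a)

punchInView : ∀ {n} (v u : Fin (suc n)) → PunchInView v u
punchInView v u with v ≟ u
... | yes refl = pivot
... | no v≢u   = subst (PunchInView v) (punchIn-punchOut v≢u) (old (punchOut v≢u))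

adj⇒≢ : ∀ {n} (G : Graph n) {u v} → adj G u v ≡ true → u ≢ v
adj⇒≢ G {u} uv refl with trans (sym uv) (irrefl G u)
... | ()

module _ {n m} (G : Graph n) (c : Fin n → Fin n → Fin m) {i : Fin m} {u v : Fin n} where

  colourClass⁺ : adj G u v ≡ true → c u v ≡ i → colourClass G c i u v ≡ true
  colourClass⁺ uv refl rewrite uv = isYes-true (c u v ≟ c u v) refl

  colourClass⁻ : colourClass G c i u v ≡ true → adj G u v ≡ true × c u v ≡ i
  colourClass⁻ with adj G u v | c u v ≟ i
  ... | true  | yes uv≡i = λ _ → refl , uv≡i
  ... | true  | no _     = λ ()
  ... | false | _        = λ ()

StarAround : ∀ {n} → (Fin n → Fin n → Bool) → Fin n → (Fin n → Set) → Set
StarAround A c S = ∀ {x y} → S x → A x y ≡ true → (x ≡ c ⊎ y ≡ c) × S y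

module _ {n} {A : Fin n → Fin n → Bool} where

  centre : IsStarForest A → Fin n → Fin n
  centre sf u = proj₁ (sf u)

  middle-is-centre : (sf : IsStarForest A) {a x b : Fin n} →
                     A a x ≡ true → A x b ≡ true → a ≢ b → x ≡ centre sf a
  middle-is-centre sf {a} {x} {b} ax xb a≢b with sf a
  ... | c , _ , star with star a x ε ax | star x b (ax ◅ ε) xb
  ...   | inj₂ x≡c | _        = x≡c
  ...   | inj₁ _   | inj₁ x≡c = x≡c
  ...   | inj₁ a≡c | inj₂ b≡c = ⊥-elim (a≢b (trans a≡c (sym b≡c)))

  StarAround-closed : ∀ {c S x z} → StarAround A c S → S x → Reach A x z → S z
  StarAround-closed star Sx ε        = Sx
  StarAround-closed star Sx (xy ◅ r) = StarAround-closed star (proj₂ (star Sx xy)) r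

  isStarForest-intro :
    (∀ u → ∃ λ c → Reach A u c × ∃ λ S → S u × StarAround A c S) → IsStarForest A
  isStarForest-intro around u with around u
  ... | c , u↝c , S , Su , star =
    c , u↝c , λ x y u↝x xy → proj₁ (star (StarAround-closed star Su u↝x) xy)

-- Ordered colourings and the upper bound

EarlierNeighbour : ∀ {n} → Graph n → (Fin n → ℕ) → Fin n → Fin n → Set
EarlierNeighbour G rank u v = adj G u v ≡ true × rank v < rank u

record OrderedColouring {n} (m : ℕ) (G : Graph n) : Set where
  field
    colour          : Fin n → Fin m
    rank            : Fin n → ℕ
    rank<           : ∀ u → rank u < n
    rank-injective  : Injective _≡_ _≡_ rank
    proper          : ∀ {u v} → adj G u v ≡ true → colour u ≢ colour v
    earlier-rainbow : ∀ {u v w} →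
                      EarlierNeighbour G rank u v → EarlierNeighbour G rank u w →
                      colour v ≡ colour w → v ≡ w

module EarlierEndpointColouring {n m} {G : Graph n} (O : OrderedColouring m G) where
  open OrderedColouring O

  earlier : Fin n → Fin n → Fin n
  earlier x y with rank x <? rank y
  ... | yes _ = x
  ... | no _  = y

  edgeColour : Fin n → Fin n → Fin m
  edgeColour x y = colour (earlier x y)

  edgeColour-sym : ∀ x y → edgeColour x y ≡ edgeColour y x
  edgeColour-sym x y with rank x <? rank y | rank y <? rank x
  ... | yes x<y | yes y<x = ⊥-elim (<-asym x<y y<x)
  ... | yes _   | no _    = refl
  ... | no _    | yes _   = refl
  ... | no x≮y  | no y≮x  =
    cong colour (rank-injective (≤-antisym (≮⇒≥ x≮y) (≮⇒≥ y≮x)))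

  Class : Fin m → Fin n → Fin n → Bool
  Class = colourClass G edgeColour

  LowerEnd : Fin m → Fin n → Fin n → Set
  LowerEnd i x y = EarlierNeighbour G rank y x × colour x ≡ i

  Class⁻ : ∀ {i x y} → Class i x y ≡ true → LowerEnd i x y ⊎ LowerEnd i y x
  Class⁻ {i} {x} {y} e with colourClass⁻ G edgeColour e
  ... | xy , xy≡i with rank x <? rank y
  ...   | yes x<y = inj₁ ((trans (adj-sym G y x) xy , x<y) , xy≡i)
  ...   | no x≮y  =
    inj₂ ((xy , ≤∧≢⇒< (≮⇒≥ x≮y) (adj⇒≢ G xy ∘ sym ∘ rank-injective)) ,
          xy≡i)

  StarOf : Fin n → Fin n → Set
  StarOf u x = x ≡ u ⊎ EarlierNeighbour G rank x u

  StarOf-around : ∀ {i u} → colour u ≡ i → StarAround (Class i) u (StarOf u)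
  StarOf-around u≡i (inj₁ refl) xy with Class⁻ xy
  ... | inj₁ (yu , _)         = inj₁ refl , inj₂ yu
  ... | inj₂ ((uy , _) , y≡i) = ⊥-elim (proper uy (trans u≡i (sym y≡i)))
  StarOf-around u≡i (inj₂ xu) xy with Class⁻ xy
  ... | inj₁ (_ , x≡i)         = ⊥-elim (proper (proj₁ xu) (trans x≡i (sym u≡i)))
  ... | inj₂ (xy′ , y≡i)       = inj₂ y≡u , inj₁ y≡u
    where y≡u = earlier-rainbow xy′ xu (trans y≡i (sym u≡i))

  Class-isStarForest : ∀ i → IsStarForest (Class i)
  Class-isStarForest i = isStarForest-intro around
    where
    around : ∀ u → ∃ λ c → Reach (Class i) u c ×
                           ∃ λ S → S u × StarAround (Class i) c S
    around u with colour u ≟ i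
    ... | yes u≡i = u , ε , StarOf u , inj₁ refl , StarOf-around u≡i
    ... | no u≢i with any? (λ w → Class i u w ≟ᵇ true)
    ...   | yes (w , uw) with Class⁻ uw
    ...     | inj₁ (_ , u≡i)  = ⊥-elim (u≢i u≡i)
    ...     | inj₂ (wu , w≡i) = w , uw ◅ ε , StarOf w , inj₂ wu , StarOf-around w≡i
    around u | no _ | no isolated =
      u , ε , (_≡ u) , refl , λ { refl uy → ⊥-elim (isolated (_ , uy)) }

OrderedColouring⇒StarArboricityAtMost : ∀ {n m} {G : Graph n} →
                                        OrderedColouring m G → StarArboricityAtMost m G
OrderedColouring⇒StarArboricityAtMost O = edgeColour , edgeColour-sym , Class-isStarForest
  where open EarlierEndpointColouring O

OrderedColouring-⊆ : ∀ {n m} {G H : Graph n} →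
                     SpanningSubgraph G H → OrderedColouring m H → OrderedColouring m G
OrderedColouring-⊆ G⊆H O = record
  { colour          = colour
  ; rank            = rank
  ; rank<           = rank<
  ; rank-injective  = rank-injective
  ; proper          = λ uv → proper (G⊆H _ _ uv)
  ; earlier-rainbow = λ (uv , v<u) (uw , w<u) →
                        earlier-rainbow (G⊆H _ _ uv , v<u) (G⊆H _ _ uw , w<u)
  }
  where open OrderedColouring O

injectiveOrderedColouring : ∀ {n m} {G : Graph n} → n ≤ m → OrderedColouring m G
injectiveOrderedColouring {G = G} n≤m = record
  { colour          = λ u → inject≤ u n≤m
  ; rank            = toℕ
  ; rank<           = toℕ<n
  ; rank-injective  = toℕ-injective
  ; proper          = λ uv → adj⇒≢ G uv ∘ inject≤-injective n≤m n≤m _ _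
  ; earlier-rainbow = λ _ _ → inject≤-injective n≤m n≤m _ _
  }

module StackedOrderedColouring
  {k m n} (G : Graph (suc n)) (v : Fin (suc n)) (f : Fin k → Fin n)
  (f-onto   : ∀ a → adj G v (punchIn v a) ≡ true → ∃ λ i → f i ≡ a)
  (f-clique : ∀ i j → i ≢ j → adj G (punchIn v (f i)) (punchIn v (f j)) ≡ true)
  (k<m : k < m) (O : OrderedColouring m (delete G v))
  where
  private module O = OrderedColouring O

  neighbours-rainbow : ∀ {a b} →
                       adj G v (punchIn v a) ≡ true → adj G v (punchIn v b) ≡ true →
                       O.colour a ≡ O.colour b → a ≡ b
  neighbours-rainbow va vb a≡b with f-onto _ va | f-onto _ vb
  ... | i , refl | j , refl with i ≟ j
  ...   | yes refl = refl
  ...   | no i≢j   = ⊥-elim (O.proper (f-clique i j i≢j) a≡b)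

  freshColour : ∃ λ c → ∀ i → O.colour (f i) ≢ c
  freshColour = <⇒∃-∉-image k<m (O.colour ∘ f)

  c₀ : Fin m
  c₀ = proj₁ freshColour

  neighbour-≢c₀ : ∀ {a} → adj G v (punchIn v a) ≡ true → O.colour a ≢ c₀
  neighbour-≢c₀ va with f-onto _ va
  ... | i , refl = proj₂ freshColour i

  colour : Fin (suc n) → Fin m
  colour = insertAt O.colour v c₀

  rank : Fin (suc n) → ℕ
  rank = insertAt O.rank v n

  colour-pivot : colour v ≡ c₀
  colour-pivot = insertAt-lookup O.colour v c₀

  colour-old : ∀ a → colour (punchIn v a) ≡ O.colour a
  colour-old = insertAt-punchIn O.colour v c₀

  rank-pivot : rank v ≡ n
  rank-pivot = insertAt-lookup O.rank v n

  rank-old : ∀ a → rank (punchIn v a) ≡ O.rank a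
  rank-old = insertAt-punchIn O.rank v n

  pivot-is-last : ∀ {a} → ¬ rank v < rank (punchIn v a)
  pivot-is-last {a} v<a rewrite rank-pivot | rank-old a = <-asym v<a (O.rank< a)

  rank< : ∀ u → rank u < suc n
  rank< u with punchInView v u
  ... | pivot rewrite rank-pivot = n<1+n n
  ... | old a rewrite rank-old a = m<n⇒m<1+n (O.rank< a)

  rank-injective : Injective _≡_ _≡_ rank
  rank-injective {u} {w} u≡w with punchInView v u | punchInView v w
  ... | pivot | pivot = refl
  ... | pivot | old b rewrite rank-pivot | rank-old b = ⊥-elim (<-irrefl (sym u≡w) (O.rank< b))
  ... | old a | pivot rewrite rank-pivot | rank-old a = ⊥-elim (<-irrefl u≡w (O.rank< a))
  ... | old a | old b rewrite rank-old a | rank-old b = cong (punchIn v) (O.rank-injective u≡w)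

  proper : ∀ {u w} → adj G u w ≡ true → colour u ≢ colour w
  proper {u} {w} uw with punchInView v u | punchInView v w
  ... | pivot | pivot = ⊥-elim (adj⇒≢ G uw refl)
  ... | pivot | old b rewrite colour-pivot | colour-old b = neighbour-≢c₀ uw ∘ sym
  ... | old a | pivot rewrite colour-pivot | colour-old a =
    neighbour-≢c₀ (trans (adj-sym G v _) uw)
  ... | old a | old b rewrite colour-old a | colour-old b = O.proper uw

  earlier-rainbow : ∀ {u w₁ w₂} →
                    EarlierNeighbour G rank u w₁ → EarlierNeighbour G rank u w₂ →
                    colour w₁ ≡ colour w₂ → w₁ ≡ w₂
  earlier-rainbow {u} {w₁} {w₂} (uw₁ , w₁<u) (uw₂ , w₂<u) w₁≡w₂
    with punchInView v u | punchInView v w₁ | punchInView v w₂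
  ... | pivot | pivot | _     = ⊥-elim (adj⇒≢ G uw₁ refl)
  ... | pivot | old _ | pivot = ⊥-elim (adj⇒≢ G uw₂ refl)
  ... | pivot | old a₁ | old a₂ rewrite colour-old a₁ | colour-old a₂ =
    cong (punchIn v) (neighbours-rainbow uw₁ uw₂ w₁≡w₂)
  ... | old _ | pivot | _     = ⊥-elim (pivot-is-last w₁<u)
  ... | old _ | old _ | pivot = ⊥-elim (pivot-is-last w₂<u)
  ... | old b | old a₁ | old a₂
    rewrite rank-old b | rank-old a₁ | rank-old a₂ | colour-old a₁ | colour-old a₂ =
    cong (punchIn v) (O.earlier-rainbow (uw₁ , w₁<u) (uw₂ , w₂<u) w₁≡w₂)

  orderedColouring : OrderedColouring m G
  orderedColouring = record
    { colour = colour ; rank = rank ; rank< = rank< ; rank-injective = rank-injective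
    ; proper = proper ; earlier-rainbow = earlier-rainbow }

KTree⇒OrderedColouring : ∀ {k m n} {H : Graph n} →
                         k < m → KTree k H → OrderedColouring m H
KTree⇒OrderedColouring k<m (base H _) = injectiveOrderedColouring k<m
KTree⇒OrderedColouring k<m (step H v f _ f-onto _ f-clique T) =
  StackedOrderedColouring.orderedColouring H v f f-onto f-clique k<m
    (KTree⇒OrderedColouring k<m T)

TreewidthAtMost⇒StarArboricityAtMost : ∀ {k n} {G : Graph n} →
                                       TreewidthAtMost k G → StarArboricityAtMost (suc k) G
TreewidthAtMost⇒StarArboricityAtMost {G = G} (j , j≤k , H , T , G⊆H) =
  OrderedColouring⇒StarArboricityAtMost
    (OrderedColouring-⊆ {G = G} G⊆H (KTree⇒OrderedColouring (s≤s j≤k) T))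

-- The lower bound

apex-is-centre : ∀ {n m} (G : Graph n) (c : Fin n → Fin n → Fin m) →
                 (∀ u v → c u v ≡ c v u) →
                 (sf : ∀ i → IsStarForest (colourClass G c i)) →
                 ∀ {x y} {K : Fin m → Fin n} →
                 Injective _≡_ _≡_ K → (∀ a → K a ≢ y) →
                 adj G x y ≡ true → (∀ a → adj G x (K a) ≡ true) →
                 ∃₂ λ a i → x ≡ centre (sf i) (K a)
apex-is-centre {m = m} G c c-sym sf {x} {y} {K} K-inj y∉K xy xK
  with pigeonhole (n<1+n m) (λ s → c x ((y ∷ K) s))
-- y is listed first, so the later of the two equally coloured edges ends in K.
... | s , suc a , s<a , same =
  a , _ , middle-is-centre (sf _)
            (colourClass⁺ G c (trans (adj-sym G _ x) (xK a)) (c-sym _ x))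
            (colourClass⁺ G c (neighbour s) same)
            (<⇒≢ᶠ s<a ∘ injective-∷ K-inj y∉K ∘ sym)
  where
  neighbour : ∀ s → adj G x ((y ∷ K) s) ≡ true
  neighbour zero    = xy
  neighbour (suc b) = xK b

manyApexes⇒¬StarArboricityAtMost :
  ∀ {n k} {G : Graph n} (K : Fin k → Fin n) (x y : Fin (suc (k * k)) → Fin n) →
  Injective _≡_ _≡_ K → Injective _≡_ _≡_ x → (∀ t a → K a ≢ y t) →
  (∀ t → adj G (x t) (y t) ≡ true) → (∀ t a → adj G (x t) (K a) ≡ true) →
  ¬ StarArboricityAtMost k G
manyApexes⇒¬StarArboricityAtMost {n} {k} {G} K x y K-inj x-inj y∉K xy xK (c , c-sym , sf) =
  <⇒notInjective (n<1+n (k * k)) index-injective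
  where
  centreOf : Fin k × Fin k → Fin n
  centreOf (a , i) = centre (sf i) (K a)

  centreIndex : ∀ t → ∃ λ ai → x t ≡ centreOf ai
  centreIndex t with apex-is-centre G c c-sym sf K-inj (y∉K t) (xy t) (xK t)
  ... | a , i , x≡ = (a , i) , x≡

  index : Fin (suc (k * k)) → Fin (k * k)
  index t = Product.uncurry combine (proj₁ (centreIndex t))

  index-injective : Injective _≡_ _≡_ index
  index-injective {t₁} {t₂} same = x-inj (begin
    x t₁                              ≡⟨ proj₂ (centreIndex t₁) ⟩
    centreOf (proj₁ (centreIndex t₁)) ≡⟨ cong centreOf same-pair ⟩
    centreOf (proj₁ (centreIndex t₂)) ≡⟨ proj₂ (centreIndex t₂) ⟨
    x t₂                              ∎)
    where
    open ≡-Reasoning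
    same-pair : proj₁ (centreIndex t₁) ≡ proj₁ (centreIndex t₂)
    same-pair = ×-≡,≡→≡ (combine-injective _ _ _ _ same)

extend : ∀ {n} → Graph n → (Fin n → Bool) → Graph (suc n)
adj (extend G N) zero    zero    = false
adj (extend G N) zero    (suc b) = N b
adj (extend G N) (suc a) zero    = N a
adj (extend G N) (suc a) (suc b) = adj G a b
adj-sym (extend G N) zero    zero    = refl
adj-sym (extend G N) zero    (suc b) = refl
adj-sym (extend G N) (suc a) zero    = refl
adj-sym (extend G N) (suc a) (suc b) = adj-sym G a b
irrefl (extend G N) zero    = refl
irrefl (extend G N) (suc a) = irrefl G a

complete : ∀ n → Graph n
complete zero    = record { adj = λ () ; adj-sym = λ () ; irrefl = λ () }
complete (suc n) = extend (complete n) (λ _ → true)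

complete-adj : ∀ {n} {u v : Fin n} → u ≢ v → adj (complete n) u v ≡ true
complete-adj {u = zero}  {zero}  u≢v = ⊥-elim (u≢v refl)
complete-adj {u = zero}  {suc v} _   = refl
complete-adj {u = suc u} {zero}  _   = refl
complete-adj {u = suc u} {suc v} u≢v = complete-adj (u≢v ∘ cong suc)

IsClique : ∀ {k n} → Graph n → (Fin k → Fin n) → Set
IsClique G K = ∀ a b → a ≢ b → adj G (K a) (K b) ≡ true

stack : ∀ {k n} → Graph n → (Fin k → Fin n) → Graph (suc n)
stack G K = extend G (λ b → ⌊ any? (λ a → K a ≟ b) ⌋)

stack-adj : ∀ {k n} (G : Graph n) (K : Fin k → Fin n) a →
            adj (stack G K) zero (suc (K a)) ≡ true
stack-adj G K a = isYes-true (any? (λ a′ → K a′ ≟ K a)) (a , refl)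

stack-KTree : ∀ {k n} {G : Graph n} {K : Fin k → Fin n} →
              KTree k G → Injective _≡_ _≡_ K → IsClique G K → KTree k (stack G K)
stack-KTree {G = G} {K} T K-inj K-clique = step _ zero K K-inj onto (stack-adj G K) K-clique T
  where
  onto : ∀ b → adj (stack G K) zero (suc b) ≡ true → ∃ λ a → K a ≡ b
  onto b with any? (λ a → K a ≟ b)
  ... | yes hit = λ _ → hit
  ... | no _    = λ ()

-- Start from K_{k+2} with the clique on vertices 1, …, k+1; each round stacks a new apex on
-- the clique, then its pendant on the apex together with the clique minus its first vertex.
module Obstruction (k : ℕ) where

  order : ℕ → ℕ
  order zero    = suc (suc k)
  order (suc m) = suc (suc (order m))

  clique : ∀ m → Fin (suc k) → Fin (order m)
  clique zero    = suc
  clique (suc m) a = suc (suc (clique m a))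

  apex pendant : ∀ m → Fin m → Fin (order m)
  apex    (suc m) zero    = suc zero
  apex    (suc m) (suc t) = suc (suc (apex m t))
  pendant (suc m) zero    = zero
  pendant (suc m) (suc t) = suc (suc (pendant m t))

  pendantBase : ∀ m → Fin (suc k) → Fin (suc (order m))
  pendantBase m zero    = zero
  pendantBase m (suc a) = suc (clique m (suc a))

  graph : ∀ m → Graph (order m)
  graph zero    = complete (suc (suc k))
  graph (suc m) = stack (stack (graph m) (clique m)) (pendantBase m)

  clique-injective : ∀ m → Injective _≡_ _≡_ (clique m)
  clique-injective zero    = suc-injective
  clique-injective (suc m) = clique-injective m ∘ suc-injective ∘ suc-injective

  clique-isClique : ∀ m → IsClique (graph m) (clique m)
  clique-isClique zero    a b a≢b = complete-adj (a≢b ∘ suc-injective)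
  clique-isClique (suc m) = clique-isClique m

  pendantBase-injective : ∀ m → Injective _≡_ _≡_ (pendantBase m)
  pendantBase-injective m {zero}  {zero}  _  = refl
  pendantBase-injective m {suc a} {suc b} eq = clique-injective m (suc-injective eq)

  pendantBase-isClique : ∀ m → IsClique (stack (graph m) (clique m)) (pendantBase m)
  pendantBase-isClique m zero    zero    a≢b = ⊥-elim (a≢b refl)
  pendantBase-isClique m zero    (suc b) _   = stack-adj (graph m) (clique m) (suc b)
  pendantBase-isClique m (suc a) zero    _   = stack-adj (graph m) (clique m) (suc a)
  pendantBase-isClique m (suc a) (suc b) a≢b = clique-isClique m (suc a) (suc b) a≢b

  graph-KTree : ∀ m → KTree (suc k) (graph m)
  graph-KTree zero    = base _ (λ _ _ → complete-adj)
  graph-KTree (suc m) =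
    stack-KTree (stack-KTree (graph-KTree m) (clique-injective m) (clique-isClique m))
                (pendantBase-injective m) (pendantBase-isClique m)

  apex-injective : ∀ m → Injective _≡_ _≡_ (apex m)
  apex-injective (suc m) {zero}  {zero}  _  = refl
  apex-injective (suc m) {suc s} {suc t} eq =
    cong suc (apex-injective m (suc-injective (suc-injective eq)))

  clique≢pendant : ∀ m t a → clique m a ≢ pendant m t
  clique≢pendant (suc m) zero    a ()
  clique≢pendant (suc m) (suc t) a = clique≢pendant m t a ∘ suc-injective ∘ suc-injective

  apex-adj-pendant : ∀ m t → adj (graph m) (apex m t) (pendant m t) ≡ true
  apex-adj-pendant (suc m) zero    = stack-adj (stack (graph m) (clique m)) (pendantBase m) zero
  apex-adj-pendant (suc m) (suc t) = apex-adj-pendant m t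

  apex-adj-clique : ∀ m t a → adj (graph m) (apex m t) (clique m a) ≡ true
  apex-adj-clique (suc m) zero    a = stack-adj (graph m) (clique m) a
  apex-adj-clique (suc m) (suc t) a = apex-adj-clique m t a

  size : ℕ
  size = suc (suc k * suc k)

  treewidth : TreewidthAtMost (suc k) (graph size)
  treewidth = suc k , ≤-refl , graph size , graph-KTree size , λ _ _ uv → uv

  ¬starArboricity : ¬ StarArboricityAtMost (suc k) (graph size)
  ¬starArboricity =
    manyApexes⇒¬StarArboricityAtMost {G = graph size} (clique size) (apex size) (pendant size)
    (clique-injective size) (apex-injective size) (clique≢pendant size)
    (apex-adj-pendant size) (apex-adj-clique size)

proposition4 : (k : ℕ) → k ≥ 1 →
    ((n : ℕ) (G : Graph n) → TreewidthAtMost k G → StarArboricityAtMost (suc k) G)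
    × Σ ℕ (λ n → Σ (Graph n) λ G → TreewidthAtMost k G × ¬ StarArboricityAtMost k G)
proposition4 (suc k) _ =
  (λ _ G → TreewidthAtMost⇒StarArboricityAtMost {G = G}) ,
  (_ , graph size , treewidth , ¬starArboricity)
  where open Obstruction k
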